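{- Let $G$ be a graph of order $n$ which has a fort $F$ with $|F|\leq Z(G)+1$. Then $z(G;i)\leq\binom{n}{i}-\binom{n-i-1}{i}$ for $1\leq i\leq n$.
   Context: A fort of a graph $G=(V,E)$ is a non-empty set $F\subseteq V$ such that no vertex outside $F$ is adjacent to exactly one vertex in $F$. Zero forcing: given a set of colored vertices, a colored vertex $u$ with exactly one uncolored neighbor $v$ may force $v$ to become colored; $S$ is a zero forcing set if starting with $S$ colored and repeatedly applying this rule colors all vertices. $Z(G)$ is the minimum size of a zero forcing set and $z(G;i)$ the number of zero forcing sets of size $i$. Convention: $\binom{a}{b}=0$ whenever $a<b$ (including negative $a$). -}

module Defs where

open import Level using (0ℓ)
open import Data.Nat using (ℕ; suc; _≤_)
open import Data.Fin using (Fin)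
open import Data.Fin.Subset using (Subset; _∈_; _∉_; _∪_; ⁅_⁆; ⊤; ∣_∣; Nonempty)
open import Data.Product using (Σ; ∃; _×_)
open import Relation.Nullary using (¬_)
open import Relation.Binary.PropositionalEquality using (_≡_)
open import Relation.Binary.Construct.Closure.ReflexiveTransitive using (Star)

record Graph (n : ℕ) : Set₁ where
  field
    Adj    : Fin n → Fin n → Set
    sym    : ∀ {u v} → Adj u v → Adj v u
    irrefl : ∀ {u} → ¬ Adj u u
open Graph public

ExactlyOneNbrIn : ∀ {n} → Graph n → Fin n → Subset n → Set
ExactlyOneNbrIn G v F =
  Σ _ λ u → u ∈ F × Adj G v u × (∀ w → w ∈ F → Adj G v w → w ≡ u)

IsFort : ∀ {n} → Graph n → Subset n → Set
IsFort G F = Nonempty F × (∀ v → v ∉ F → ¬ ExactlyOneNbrIn G v F)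

data ForceStep {n} (G : Graph n) : Subset n → Subset n → Set where
  force : ∀ {S} u v → u ∈ S → v ∉ S → Adj G u v →
          (∀ w → Adj G u w → w ∉ S → w ≡ v) →
          ForceStep G S (S ∪ ⁅ v ⁆)

IsZFS : ∀ {n} → Graph n → Subset n → Set
IsZFS G S = Star (ForceStep G) S ⊤

IsZeroForcingNumber : ∀ {n} → Graph n → ℕ → Set
IsZeroForcingNumber G k =
  (∃ λ S → IsZFS G S × ∣ S ∣ ≡ k) × (∀ S → IsZFS G S → k ≤ ∣ S ∣)

module Submission where

-- Every zero forcing set S meets every fort F: a forcing step
-- cannot colour the first vertex of F, since the forcing vertex would then be
-- a vertex outside F with exactly one neighbour in F.  Hence the zero forcing
-- sets of size i are among the i-subsets of the n vertices that meet F, and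
-- there are at most  C(n,i) - C(n-|F|,i)  of those (the i-subsets missing F
-- are exactly the i-subsets of the complement of F).  If there is a zero
-- forcing set of size i at all, then Z(G) ≤ i, so |F| ≤ i + 1 and
-- n - i - 1 ≤ n - |F|; monotonicity of binomials in the top argument turns the
-- bound into  C(n,i) - C(n-i-1,i).
--
-- Counting is done on duplicate-free lists of subsets of Fin n by induction
-- on n, splitting a list according to whether its members contain vertex 0
-- (the Pascal recurrence).

open import Defs
open import Data.Nat using (ℕ; zero; suc; _≤_; _<_; _≤′_; ≤′-refl; ≤′-step; _∸_; _+_; z≤n)
open import Data.Nat.Properties
open import Algebra.Properties.CommutativeSemigroup +-commutativeSemigroup
  using (interchange)
open import Data.Nat.Combinatorics using (_C_; nCk+nC[k+1]≡[n+1]C[k+1])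
open import Data.Fin using () renaming (suc to fsuc)
open import Data.Fin.Subset
  using (Subset; ∣_∣; _∈_; _∉_; _∩_; _∪_; _─_; ⁅_⁆; ⊤; Nonempty; inside; outside)
open import Data.Fin.Subset.Properties
  using (∈⊤; x∈p∪q⁻; x∈⁅y⁆⇒x≡y; x∈p∩q⁺; x∈p∩q⁻; nonempty?; ∣p∣≤n; p∩q≢∅⇒∣p─q∣<∣p∣)
open import Data.Vec using ([]; _∷_; there)
open import Data.Bool using (Bool) renaming (_≟_ to _≟ᵇ_)
open import Data.List using (List; length; []; _∷_)
open import Data.List.Relation.Unary.All as All using (All; []; _∷_)
open import Data.List.Relation.Unary.AllPairs using ([]; _∷_)
open import Data.List.Relation.Unary.Unique.Propositional using (Unique)
open import Data.Product using (Σ; _×_; _,_)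
open import Data.Sum using (inj₁; inj₂)
open import Data.Empty using (⊥; ⊥-elim)
open import Relation.Nullary using (yes; no; contradiction)
open import Relation.Binary.PropositionalEquality
  using (_≡_; refl; trans; cong; cong₂; subst) renaming (sym to ≡-sym)
open import Relation.Binary.Construct.Closure.ReflexiveTransitive using (ε; _◅_)

private
  variable
    n : ℕ

Meets : Subset n → Subset n → Set
Meets S F = Nonempty (S ∩ F)

size-zero-meets-nothing : (S F : Subset n) → ∣ S ∣ ≡ 0 → Meets S F → ⊥
size-zero-meets-nothing S F ∣S∣≡0 m =
  n≮0 (subst (∣ S ─ F ∣ <_) ∣S∣≡0 (p∩q≢∅⇒∣p─q∣<∣p∣ S F m))

drop-outside : {p : Subset n} → Nonempty (outside ∷ p) → Nonempty p
drop-outside (fsuc x , there x∈p) = x , x∈p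

-- A single forcing step never colours the first vertex of a fort: if the set
-- after the step meets the fort F, the set before it already did.  Otherwise
-- the newly coloured vertex v lies in F, and the forcing vertex u lies outside
-- F with v as its only neighbour in F.
force-step-meets : (G : Graph n) (F : Subset n) → IsFort G F →
  ∀ {S S′} → ForceStep G S S′ → Meets S′ F → Meets S F
force-step-meets G F (_ , no-lone-nbr) {S} (force u v u∈S _ u~v only-v) (w , w∈S′∩F)
  with nonempty? (S ∩ F)
... | yes S-meets-F = S-meets-F
... | no S-misses-F with x∈p∩q⁻ (S ∪ ⁅ v ⁆) F w∈S′∩F
... | w∈S′ , w∈F with x∈p∪q⁻ S ⁅ v ⁆ w∈S′
...   | inj₁ w∈S = contradiction (w , x∈p∩q⁺ (w∈S , w∈F)) S-misses-F
...   | inj₂ w∈⁅v⁆ with x∈⁅y⁆⇒x≡y v w∈⁅v⁆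
...     | refl = ⊥-elim (no-lone-nbr u u∉F (w , w∈F , u~v , only-nbr-in-F))
  where
    misses : ∀ {x} → x ∈ S → x ∈ F → ⊥
    misses x∈S x∈F = S-misses-F (_ , x∈p∩q⁺ (x∈S , x∈F))
    u∉F : u ∉ F
    u∉F = misses u∈S
    only-nbr-in-F : ∀ x → x ∈ F → Adj G u x → x ≡ w
    only-nbr-in-F x x∈F u~x = only-v x u~x (λ x∈S → misses x∈S x∈F)

zfs-meets-fort : (G : Graph n) (F : Subset n) → IsFort G F →
  ∀ S → IsZFS G S → Meets S F
zfs-meets-fort G F ((x , x∈F) , _) S ε = x , x∈p∩q⁺ (∈⊤ , x∈F)
zfs-meets-fort G F fort S (step ◅ chain) =
  force-step-meets G F fort step (zfs-meets-fort G F fort _ chain)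

-- The tails of those members of L whose entry at vertex 0 is b.  Splitting a
-- list of subsets of Fin (suc n) by b = inside / outside is the combinatorial
-- content of Pascal's rule.
tailsWithHead : Bool → List (Subset (suc n)) → List (Subset n)
tailsWithHead b [] = []
tailsWithHead b ((c ∷ p) ∷ L) with b ≟ᵇ c
... | yes _ = p ∷ tailsWithHead b L
... | no _  = tailsWithHead b L

length-split : (L : List (Subset (suc n))) →
  length L ≡ length (tailsWithHead inside L) + length (tailsWithHead outside L)
length-split [] = refl
length-split ((inside ∷ p) ∷ L) = cong suc (length-split L)
length-split ((outside ∷ p) ∷ L) =
  trans (cong suc (length-split L)) (≡-sym (+-suc (length (tailsWithHead inside L)) _))

All-tailsWithHead : ∀ {P : Subset (suc n) → Set} {Q : Subset n → Set} b →
  (∀ p → P (b ∷ p) → Q p) → ∀ {L} → All P L → All Q (tailsWithHead b L)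
All-tailsWithHead b f [] = []
All-tailsWithHead b f {(c ∷ p) ∷ L} (Pcp ∷ PL) with b ≟ᵇ c
... | yes refl = f p Pcp ∷ All-tailsWithHead b f PL
... | no _     = All-tailsWithHead b f PL

Unique-tailsWithHead : ∀ b {L : List (Subset (suc n))} → Unique L → Unique (tailsWithHead b L)
Unique-tailsWithHead b [] = []
Unique-tailsWithHead b {(c ∷ p) ∷ L} (distinct ∷ uniq) with b ≟ᵇ c
... | yes refl = All-tailsWithHead b (λ q p≢ p≡q → p≢ (cong (b ∷_) p≡q)) distinct
                 ∷ Unique-tailsWithHead b uniq
... | no _     = Unique-tailsWithHead b uniq

length-All-⊥ : ∀ {A : Set} {L : List A} → All (λ _ → ⊥) L → length L ≡ 0
length-All-⊥ [] = refl

distinct-k-subsets≤ : ∀ n k (L : List (Subset n)) → Unique L →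
  All (λ S → ∣ S ∣ ≡ k) L → length L ≤ n C k
distinct-k-subsets≤ zero k [] _ _ = z≤n
distinct-k-subsets≤ zero .0 ([] ∷ []) _ (refl ∷ []) = ≤-refl
distinct-k-subsets≤ zero k ([] ∷ [] ∷ L) ((≢[] ∷ _) ∷ _) _ = ⊥-elim (≢[] refl)
distinct-k-subsets≤ (suc n) zero L uniq sizes = begin
  length L                                   ≡⟨ length-split L ⟩
  length (tailsWithHead inside L) + length (tailsWithHead outside L)
    ≡⟨ cong (_+ length (tailsWithHead outside L)) (length-All-⊥ (All-tailsWithHead inside (λ _ ()) sizes)) ⟩
  length (tailsWithHead outside L)
    ≤⟨ distinct-k-subsets≤ n 0 _ (Unique-tailsWithHead outside uniq)
                                 (All-tailsWithHead outside (λ _ e → e) sizes) ⟩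
  1                                          ∎
  where open ≤-Reasoning
distinct-k-subsets≤ (suc n) (suc k) L uniq sizes = begin
  length L                                   ≡⟨ length-split L ⟩
  length (tailsWithHead inside L) + length (tailsWithHead outside L)
    ≤⟨ +-mono-≤ (distinct-k-subsets≤ n k _ (Unique-tailsWithHead inside uniq)
                   (All-tailsWithHead inside (λ _ → suc-injective) sizes))
                (distinct-k-subsets≤ n (suc k) _ (Unique-tailsWithHead outside uniq)
                   (All-tailsWithHead outside (λ _ e → e) sizes)) ⟩
  n C k + n C suc k                          ≡⟨ nCk+nC[k+1]≡[n+1]C[k+1] n k ⟩
  suc n C suc k                              ∎
  where open ≤-Reasoning

MeetingKSubset : ℕ → Subset n → Subset n → Set
MeetingKSubset k F S = ∣ S ∣ ≡ k × Meets S F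

drop-outside-head : ∀ {k c} {F p : Subset n} →
  MeetingKSubset k (c ∷ F) (outside ∷ p) → MeetingKSubset k F p
drop-outside-head (size , meets) = size , drop-outside meets

-- There are at most C(n,k) - C(n-|F|,k) distinct k-subsets of Fin n meeting F,
-- since the C(n-|F|,k) k-subsets of the complement of F do not.  Stated
-- additively for the induction: split off vertex 0 and apply Pascal's rule on
-- both sides; if vertex 0 lies in F every set containing it meets F, and the
-- plain bound above applies to those.
distinct-meeting-k-subsets : ∀ n k (F : Subset n) (L : List (Subset n)) → Unique L →
  All (MeetingKSubset k F) L → length L + (n ∸ ∣ F ∣) C k ≤ n C k
distinct-meeting-k-subsets n zero F [] _ _ = ≤-refl
distinct-meeting-k-subsets n zero F (S ∷ L) _ ((∣S∣≡0 , meets) ∷ _) =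
  ⊥-elim (size-zero-meets-nothing S F ∣S∣≡0 meets)
distinct-meeting-k-subsets zero (suc k) [] [] _ _ = ≤-refl
distinct-meeting-k-subsets zero (suc k) [] ([] ∷ L) _ ((_ , () , _) ∷ _)
distinct-meeting-k-subsets (suc n) (suc k) (outside ∷ F) L uniq members = begin
  length L + (suc n ∸ f) C suc k
    ≡⟨ cong₂ _+_ (length-split L) (cong (_C suc k) (+-∸-assoc 1 (∣p∣≤n F))) ⟩
  (ℓ-in + ℓ-out) + suc (n ∸ f) C suc k
    ≡⟨ cong ((ℓ-in + ℓ-out) +_) (≡-sym (nCk+nC[k+1]≡[n+1]C[k+1] (n ∸ f) k)) ⟩
  (ℓ-in + ℓ-out) + ((n ∸ f) C k + (n ∸ f) C suc k)
    ≡⟨ interchange ℓ-in ℓ-out ((n ∸ f) C k) ((n ∸ f) C suc k) ⟩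
  (ℓ-in + (n ∸ f) C k) + (ℓ-out + (n ∸ f) C suc k)
    ≤⟨ +-mono-≤
         (distinct-meeting-k-subsets n k F _ (Unique-tailsWithHead inside uniq)
            (All-tailsWithHead inside drop-inside-head members))
         (distinct-meeting-k-subsets n (suc k) F _ (Unique-tailsWithHead outside uniq)
            (All-tailsWithHead outside (λ _ → drop-outside-head {c = outside}) members)) ⟩
  n C k + n C suc k                       ≡⟨ nCk+nC[k+1]≡[n+1]C[k+1] n k ⟩
  suc n C suc k                           ∎
  where
    open ≤-Reasoning
    f = ∣ F ∣
    ℓ-in = length (tailsWithHead inside L)
    ℓ-out = length (tailsWithHead outside L)
    drop-inside-head : ∀ p → MeetingKSubset (suc k) (outside ∷ F) (inside ∷ p) →
      MeetingKSubset k F p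
    drop-inside-head p (size , meets) = suc-injective size , drop-outside meets
distinct-meeting-k-subsets (suc n) (suc k) (inside ∷ F) L uniq members = begin
  length L + (n ∸ f) C suc k           ≡⟨ cong (_+ (n ∸ f) C suc k) (length-split L) ⟩
  (ℓ-in + ℓ-out) + (n ∸ f) C suc k     ≡⟨ +-assoc ℓ-in ℓ-out _ ⟩
  ℓ-in + (ℓ-out + (n ∸ f) C suc k)
    ≤⟨ +-mono-≤
         (distinct-k-subsets≤ n k _ (Unique-tailsWithHead inside uniq)
            (All-tailsWithHead inside (λ _ (size , _) → suc-injective size) members))
         (distinct-meeting-k-subsets n (suc k) F _ (Unique-tailsWithHead outside uniq)
            (All-tailsWithHead outside (λ _ → drop-outside-head {c = inside}) members)) ⟩
  n C k + n C suc k                    ≡⟨ nCk+nC[k+1]≡[n+1]C[k+1] n k ⟩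
  suc n C suc k                        ∎
  where
    open ≤-Reasoning
    f = ∣ F ∣
    ℓ-in = length (tailsWithHead inside L)
    ℓ-out = length (tailsWithHead outside L)

C-step : ∀ m k → m C k ≤ suc m C k
C-step m zero    = ≤-refl
C-step m (suc k) = subst (m C suc k ≤_) (nCk+nC[k+1]≡[n+1]C[k+1] m k) (m≤n+m _ _)

C-monoˡ : ∀ k {m m′} → m ≤ m′ → m C k ≤ m′ C k
C-monoˡ k m≤m′ = go (≤⇒≤′ m≤m′)
  where
    go : ∀ {m m′} → m ≤′ m′ → m C k ≤ m′ C k
    go ≤′-refl         = ≤-refl
    go (≤′-step m≤′m′) = ≤-trans (go m≤′m′) (C-step _ k)

n∸i∸1≤n∸∣F∣ : ∀ n i f → f ≤ i + 1 → n ∸ i ∸ 1 ≤ n ∸ f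
n∸i∸1≤n∸∣F∣ n i f f≤i+1 = subst (_≤ n ∸ f) (≡-sym (∸-+-assoc n i 1)) (∸-monoʳ-≤ n f≤i+1)

proposition5p6 : (n : ℕ) (G : Graph n) (F : Subset n) → IsFort G F →
    (Σ ℕ λ Z → IsZeroForcingNumber G Z × ∣ F ∣ ≤ Z + 1) →
    (i : ℕ) → 1 ≤ i → i ≤ n →
    (L : List (Subset n)) → Unique L → All (λ S → IsZFS G S × ∣ S ∣ ≡ i) L →
    length L ≤ (n C i) ∸ ((n ∸ i ∸ 1) C i)
proposition5p6 n G F fort _ i _ _ [] _ _ = z≤n
proposition5p6 n G F fort (Z , (_ , Z-minimal) , ∣F∣≤Z+1) i _ _ L@(S ∷ _) uniq
               zfss@((S-zfs , ∣S∣≡i) ∷ _) = begin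
  length L                      ≤⟨ m+n≤o⇒m≤o∸n (length L) meeting-bound ⟩
  n C i ∸ (n ∸ ∣ F ∣) C i        ≤⟨ ∸-monoʳ-≤ (n C i) (C-monoˡ i (n∸i∸1≤n∸∣F∣ n i ∣ F ∣ ∣F∣≤i+1)) ⟩
  n C i ∸ (n ∸ i ∸ 1) C i        ∎
  where
    open ≤-Reasoning
    Z≤i : Z ≤ i
    Z≤i = subst (Z ≤_) ∣S∣≡i (Z-minimal S S-zfs)
    ∣F∣≤i+1 : ∣ F ∣ ≤ i + 1
    ∣F∣≤i+1 = ≤-trans ∣F∣≤Z+1 (+-monoˡ-≤ 1 Z≤i)
    meeting-bound : length L + (n ∸ ∣ F ∣) C i ≤ n C i
    meeting-bound = distinct-meeting-k-subsets n i F L uniq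
      (All.map (λ {T} (T-zfs , ∣T∣≡i) → ∣T∣≡i , zfs-meets-fort G F fort T T-zfs) zfss)
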